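{- Let $G \not\cong K_{2,3}$ be a connected non-bipartite quadrangulation of a surface in which every $4$-cycle is facial. Then $A \in V(\mathrm{L}(G))$ if and only if $A$ satisfies one of the following conditions: (1) $A$ is a pair of opposite vertices in a face of $G$; (2) $A = N(v)$, for some vertex $v \in V(G)$; (3) $A = \{v\}$, for some vertex $v \in V(G)$.
   Context: $\mathrm{L}(G)$ is the Lovász complex of $G$, whose vertex set is $V(\mathrm{L}(G))=\{A\subseteq V(G)\mid \mathrm{CN}^2(A)=A\}$, where $\mathrm{CN}(A)$ denotes the set of common neighbors of the vertices in $A$. A quadrangulation is a graph embedded in a surface with every face bounded by a $4$-cycle. -}

module Defs where

open import Data.Nat using (ℕ; zero; suc)
open import Data.Fin using (Fin; zero; suc; _≟_)
open import Data.Fin.Subset using (Subset; ⁅_⁆; _∪_; ⊥; ⊤)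
open import Data.Bool using (Bool; true; false; _∧_; _∨_; not; T; _xor_)
open import Data.Vec using (Vec; tabulate; lookup)
open import Data.Product using (Σ; _×_; _,_; ∃)
open import Data.Sum using (_⊎_)
open import Data.List using (List; []; _∷_)
open import Data.List.Membership.Propositional renaming (_∈_ to _∈ₗ_)
open import Relation.Binary.PropositionalEquality using (_≡_; _≢_)
open import Relation.Binary.Construct.Closure.ReflexiveTransitive using (Star)
open import Relation.Nullary using (¬_)
open import Relation.Nullary.Decidable using (⌊_⌋)
open import Function.Bundles using (_↔_; Inverse)

allFin : ∀ {n} → (Fin n → Bool) → Bool
allFin {zero}  p = true
allFin {suc n} p = p zero ∧ allFin (λ i → p (suc i))

record Graph (n : ℕ) : Set where
  field
    adj    : Fin n → Fin n → Bool
    sym    : ∀ u v → adj u v ≡ adj v u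
    irrefl : ∀ v → adj v v ≡ false
open Graph public

Adj : ∀ {n} → Graph n → Fin n → Fin n → Set
Adj G u v = T (adj G u v)

Connected : ∀ {n} → Graph n → Set
Connected G = ∀ u v → Star (Adj G) u v

Bipartite : ∀ {n} → Graph n → Set
Bipartite {n} G = Σ (Fin n → Bool) λ χ → ∀ u v → Adj G u v → χ u ≢ χ v

partK23 : Fin 5 → Bool
partK23 zero = true
partK23 (suc zero) = true
partK23 (suc (suc _)) = false

K23 : Graph 5
K23 = record
  { adj = λ x y → partK23 x xor partK23 y
  ; sym = λ x y → xor-sym (partK23 x) (partK23 y)
  ; irrefl = λ x → xor-self (partK23 x) }
  where
  xor-sym : ∀ a b → (a xor b) ≡ (b xor a)
  xor-sym true true = _≡_.refl
  xor-sym true false = _≡_.refl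
  xor-sym false true = _≡_.refl
  xor-sym false false = _≡_.refl
  xor-self : ∀ a → (a xor a) ≡ false
  xor-self true = _≡_.refl
  xor-self false = _≡_.refl

Isomorphic : ∀ {n m} → Graph n → Graph m → Set
Isomorphic {n} {m} G H =
  Σ (Fin n ↔ Fin m) λ σ → ∀ u v → adj G u v ≡ adj H (Inverse.to σ u) (Inverse.to σ v)

N : ∀ {n} → Graph n → Fin n → Subset n
N G v = tabulate (adj G v)

CN : ∀ {n} → Graph n → Subset n → Subset n
CN G A = tabulate λ w → allFin λ u → not (lookup A u) ∨ adj G u w

LovaszVertex : ∀ {n} → Graph n → Subset n → Set
LovaszVertex G A = A ≢ ⊥ × A ≢ ⊤ × CN G (CN G A) ≡ A

-- a closed walk (p0 p1 p2 p3 p0) of length 4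
record Quad (n : ℕ) : Set where
  constructor quad
  field
    p0 p1 p2 p3 : Fin n
open Quad public

edgeB : ∀ {n} → Quad n → Fin n → Fin n → Bool
edgeB (quad a b c d) x y = pr a b ∨ pr b c ∨ pr c d ∨ pr d a
  where
  pr : _ → _ → Bool
  pr s t = (⌊ x ≟ s ⌋ ∧ ⌊ y ≟ t ⌋) ∨ (⌊ x ≟ t ⌋ ∧ ⌊ y ≟ s ⌋)

QuadEdge : ∀ {n} → Quad n → Fin n → Fin n → Set
QuadEdge q x y = T (edgeB q x y)

Is4Cycle : ∀ {n} → Graph n → Quad n → Set
Is4Cycle G (quad a b c d) =
  Adj G a b × Adj G b c × Adj G c d × Adj G d a × a ≢ c × b ≢ d

countFaces : ∀ {n} → List (Quad n) → Fin n → Fin n → ℕ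
countFaces [] x y = zero
countFaces (f ∷ fs) x y with edgeB f x y
... | true  = suc (countFaces fs x y)
... | false = countFaces fs x y

LinkEdge : ∀ {n} → List (Quad n) → Fin n → Fin n → Fin n → Set
LinkEdge {n} faces v u w =
  Σ (Quad n) λ f → f ∈ₗ faces × QuadEdge f v u × QuadEdge f v w × u ≢ w

-- A quadrangulation of a closed surface (combinatorial description of a
-- 2-cell embedding): a list of faces, each bounded by a 4-cycle of G, each
-- edge of G lies on exactly two faces, and the faces around every vertex
-- form a single cycle (connected vertex link), so the resulting 2-complex
-- is a closed surface.
record Quadrangulation {n : ℕ} (G : Graph n) : Set where
  field
    faces          : List (Quad n)
    faces-4-cycles : ∀ {f} → f ∈ₗ faces → Is4Cycle G f
    edge-two-faces : ∀ u v → Adj G u v → countFaces faces u v ≡ 2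
    link-connected : ∀ v u w → Adj G v u → Adj G v w → Star (LinkEdge faces v) u w
open Quadrangulation public

AllFourCyclesFacial : ∀ {n} {G : Graph n} → Quadrangulation G → Set
AllFourCyclesFacial {n} {G} Q =
  ∀ (c : Quad n) → Is4Cycle G c →
    Σ (Quad n) λ f → f ∈ₗ faces Q × (∀ x y → edgeB f x y ≡ edgeB c x y)

OppositePair : ∀ {n} {G : Graph n} → Quadrangulation G → Subset n → Set
OppositePair {n} Q A =
  Σ (Quad n) λ f → f ∈ₗ faces Q ×
    (A ≡ ⁅ p0 f ⁆ ∪ ⁅ p2 f ⁆ ⊎ A ≡ ⁅ p1 f ⁆ ∪ ⁅ p3 f ⁆)

-- Write B = CN(A). For a Lovász vertex A, both A and B are nonempty, every vertex of A is adjacent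
-- to every vertex of B, and A = CN(B). The key fact is that G contains no K₂,₃: as every 4-cycle
-- bounds a face and every edge lies on exactly two faces, the faces at an edge of a K₂,₃ are
-- bounded by 4-cycles of the K₂,₃ itself, so going around the links of its vertices never leaves
-- it, and G, being connected, would be K₂,₃. Hence |A| ≥ 2 and |B| ≥ 2 force A ∪ B to be a 4-cycle,
-- i.e. a face, with A a pair of opposite vertices; |B| = 1 gives A = N(b) and |A| = 1 a singleton.
-- Conversely, CN(N(v)) = {v} because no u ≠ v has N(v) ⊆ N(u): a third neighbour of v would give
-- a K₂,₃, and if N(v) = {a, b} then every face at an edge of the 4-cycle v a u b is that 4-cycle,
-- so G is this 4-cycle and would be bipartite.

{-# OPTIONS --safe #-}
module Submission where

open import Defs
open import Data.Nat using (ℕ; zero; suc; _≤_; _<_; z≤n; s≤s)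
open import Data.Nat.Properties using (<-irrefl; m≤n⇒m≤1+n)
open import Data.Fin using (Fin; zero; suc; _≟_; join; splitAt)
open import Data.Fin.Properties using (any?; join-splitAt; splitAt-join)
open import Data.Fin.Subset using (Subset; ⁅_⁆; _∪_; _∈_; _∉_; _⊆_)
import Data.Fin.Subset as Subset
open import Data.Fin.Subset.Properties
  using (_∈?_; ∈⊤; ∉⊥; x∈⁅x⁆; x∈⁅y⁆⇒x≡y; x∉⁅y⁆⇒x≢y; ⊆-antisym; x∈p∪q⁺; x∈p∪q⁻; ∪-comm;
         nonempty?; Empty-unique)
open import Data.Bool using (Bool; true; false; _∧_; _∨_; not; T)
open import Data.Bool.Properties using (T-≡; T-∧; T-∨)
open import Data.Vec using (tabulate; lookup)
open import Data.Vec.Properties using (lookup∘tabulate; []=↔lookup)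
open import Data.Product using (_×_; _,_; ∃; ∃₂; proj₁; proj₂)
open import Data.Sum using (_⊎_; inj₁; inj₂; [_,_])
import Data.Sum
open import Data.List using ([]; _∷_)
open import Data.List.Relation.Unary.Any using (here; there)
open import Data.List.Membership.Propositional using () renaming (_∈_ to _∈ₗ_)
open import Data.Empty using (⊥-elim)
open import Data.Unit using (tt)
open import Relation.Binary.PropositionalEquality
  using (_≡_; _≢_; refl; cong; subst; subst₂; trans; module ≡-Reasoning) renaming (sym to ≡-sym)
open import Relation.Binary.Construct.Closure.ReflexiveTransitive using (Star; fold)
open import Relation.Nullary using (¬_; Dec; does; yes; no; contradiction)
open import Relation.Nullary.Decidable
  using (T?; ⌊_⌋; map′; _×-dec_; _⊎-dec_; ¬?; toWitness; fromWitness; dec-true; dec-false; decidable-stable)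
open import Function using (_∘_; id)
open import Function.Definitions using (Injective)
open import Function.Bundles using (_⇔_; mk⇔; Equivalence; _↔_; Inverse; mk↔ₛ′)
open import Function.Properties.Equivalence using () renaming (refl to ⇔-refl; sym to ⇔-sym; trans to ⇔-trans)
open import Data.Sum.Function.Propositional using (_⊎-⇔_)
open import Data.Product.Function.NonDependent.Propositional using (_×-⇔_)

private
  variable
    n : ℕ

_∈[_,_] : Fin n → Fin n → Fin n → Set
w ∈[ a , c ] = w ≡ a ⊎ w ≡ c

¬T⇒≡false : ∀ {b} → ¬ T b → b ≡ false
¬T⇒≡false {false} _  = refl
¬T⇒≡false {true}  ¬T = contradiction _ ¬T

T-allFin⇔ : {p : Fin n → Bool} → T (allFin p) ⇔ (∀ i → T (p i))
T-allFin⇔ {n} = mk⇔ (to n) (from n)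
  where
  to : ∀ n {p : Fin n → Bool} → T (allFin p) → ∀ i → T (p i)
  to (suc n) h zero    = proj₁ (Equivalence.to T-∧ h)
  to (suc n) h (suc i) = to n (proj₂ (Equivalence.to T-∧ h)) i
  from : ∀ n {p : Fin n → Bool} → (∀ i → T (p i)) → T (allFin p)
  from zero    h = _
  from (suc n) h = Equivalence.from T-∧ (h zero , from n (h ∘ suc))

∈-tabulate⇔ : {f : Fin n → Bool} {x : Fin n} → x ∈ tabulate f ⇔ T (f x)
∈-tabulate⇔ {f = f} {x} = mk⇔
  (λ x∈ → Equivalence.from T-≡ (trans (≡-sym (lookup∘tabulate f x)) (Inverse.to []=↔lookup x∈)))
  (λ fx → Inverse.from []=↔lookup (trans (lookup∘tabulate f x) (Equivalence.to T-≡ fx)))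

⊆-or-∉ : (A S : Subset n) → A ⊆ S ⊎ ∃ λ x → x ∈ A × x ∉ S
⊆-or-∉ A S with any? (λ x → x ∈? A ×-dec ¬? (x ∈? S))
... | yes found = inj₂ found
... | no  none  = inj₁ λ {x} x∈A → decidable-stable (x ∈? S) λ x∉S → none (x , x∈A , x∉S)

∈-pair⁺ : {a b x : Fin n} → x ∈[ a , b ] → x ∈ ⁅ a ⁆ ∪ ⁅ b ⁆
∈-pair⁺ (inj₁ refl) = x∈p∪q⁺ (inj₁ (x∈⁅x⁆ _))
∈-pair⁺ (inj₂ refl) = x∈p∪q⁺ (inj₂ (x∈⁅x⁆ _))

∈-pair⁻ : {a b x : Fin n} → x ∈ ⁅ a ⁆ ∪ ⁅ b ⁆ → x ∈[ a , b ]
∈-pair⁻ {a = a} {b} x∈ with x∈p∪q⁻ ⁅ a ⁆ ⁅ b ⁆ x∈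
... | inj₁ x∈a = inj₁ (x∈⁅y⁆⇒x≡y a x∈a)
... | inj₂ x∈b = inj₂ (x∈⁅y⁆⇒x≡y b x∈b)

∈⇒≢⊥ : ∀ {A : Subset n} {x} → x ∈ A → A ≢ Subset.⊥
∈⇒≢⊥ x∈A refl = ∉⊥ x∈A

∉⇒≢⊤ : ∀ {A : Subset n} {x} → x ∉ A → A ≢ Subset.⊤
∉⇒≢⊤ x∉A refl = x∉A ∈⊤

≢⊥⇒nonempty : ∀ {A : Subset n} → A ≢ Subset.⊥ → ∃ (_∈ A)
≢⊥⇒nonempty {A = A} A≢⊥ with nonempty? A
... | yes nonempty = nonempty
... | no  empty    = contradiction (Empty-unique empty) A≢⊥

⊆⁅⁆⇒≡ : ∀ {A : Subset n} {a} → a ∈ A → A ⊆ ⁅ a ⁆ → A ≡ ⁅ a ⁆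
⊆⁅⁆⇒≡ {a = a} a∈A A⊆a = ⊆-antisym A⊆a λ w∈a → subst (_∈ _) (≡-sym (x∈⁅y⁆⇒x≡y a w∈a)) a∈A

⊆pair⇒≡ : ∀ {A : Subset n} {a b} → a ∈ A → b ∈ A → A ⊆ ⁅ a ⁆ ∪ ⁅ b ⁆ → A ≡ ⁅ a ⁆ ∪ ⁅ b ⁆
⊆pair⇒≡ a∈A b∈A A⊆ab = ⊆-antisym A⊆ab λ w∈ab → [ (λ { refl → a∈A }) , (λ { refl → b∈A }) ] (∈-pair⁻ w∈ab)

pair-≡ : ∀ {a c s t : Fin n} → s ∈[ a , c ] → t ∈[ a , c ] → s ≢ t → ⁅ a ⁆ ∪ ⁅ c ⁆ ≡ ⁅ s ⁆ ∪ ⁅ t ⁆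
pair-≡ (inj₁ refl) (inj₁ refl) s≢t = contradiction refl s≢t
pair-≡ (inj₁ refl) (inj₂ refl) _   = refl
pair-≡ (inj₂ refl) (inj₁ refl) _   = ∪-comm _ _
pair-≡ (inj₂ refl) (inj₂ refl) s≢t = contradiction refl s≢t

Star-induction : ∀ {a r p} {V : Set a} {R : V → V → Set r} (P : V → Set p) →
  (∀ {u v} → R u v → P u → P v) → ∀ {u v} → Star R u v → P u → P v
Star-induction P step = fold (λ u v → P u → P v) (λ r k → k ∘ step r) id

module _ (G : Graph n) where

  Adj-sym : ∀ {u v} → Adj G u v → Adj G v u
  Adj-sym {u} {v} = subst T (sym G u v)

  Adj⇒≢ : ∀ {u v} → Adj G u v → u ≢ v
  Adj⇒≢ {u} uv refl = subst T (irrefl G u) uv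

  ∈-N⇔ : ∀ {v w} → w ∈ N G v ⇔ Adj G v w
  ∈-N⇔ = ∈-tabulate⇔

  ∈-CN⇔ : ∀ {A w} → w ∈ CN G A ⇔ (∀ {u} → u ∈ A → Adj G u w)
  ∈-CN⇔ {A} {w} = ⇔-trans ∈-tabulate⇔ (⇔-trans T-allFin⇔ (mk⇔ to from))
    where
    to : (∀ u → T (not (lookup A u) ∨ adj G u w)) → ∀ {u} → u ∈ A → Adj G u w
    to h {u} u∈A with lookup A u | Inverse.to []=↔lookup u∈A | h u
    ... | true | refl | uw = uw
    from : (∀ {u} → u ∈ A → Adj G u w) → ∀ u → T (not (lookup A u) ∨ adj G u w)
    from h u with lookup A u in eq
    ... | true  = h (Inverse.from []=↔lookup eq)
    ... | false = _

  CN-⊥ : CN G Subset.⊥ ≡ Subset.⊤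
  CN-⊥ = ⊆-antisym (λ _ → ∈⊤) (λ _ → Equivalence.from ∈-CN⇔ (λ u∈⊥ → contradiction u∈⊥ ∉⊥))

  CN-⁅⁆ : ∀ v → CN G ⁅ v ⁆ ≡ N G v
  CN-⁅⁆ v = ⊆-antisym
    (λ w∈ → Equivalence.from ∈-N⇔ (Equivalence.to ∈-CN⇔ w∈ (x∈⁅x⁆ v)))
    (λ w∈ → Equivalence.from ∈-CN⇔ λ u∈ → subst (λ u → Adj G u _) (≡-sym (x∈⁅y⁆⇒x≡y v u∈)) (Equivalence.to ∈-N⇔ w∈))

  CN-N : ∀ v → (∀ {u} → N G v ⊆ N G u → u ≡ v) → CN G (N G v) ≡ ⁅ v ⁆
  CN-N v undominated = ⊆-antisym
    (λ w∈ → subst (_∈ ⁅ v ⁆) (≡-sym (undominated (λ u∈ → Equivalence.from ∈-N⇔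
      (Adj-sym (Equivalence.to ∈-CN⇔ w∈ u∈))))) (x∈⁅x⁆ v))
    (λ w∈ → Equivalence.from ∈-CN⇔ λ u∈ → subst (Adj G _) (≡-sym (x∈⁅y⁆⇒x≡y v w∈))
      (Adj-sym (Equivalence.to ∈-N⇔ u∈)))

  CN-adjacent : ∀ {A a b} → b ∈ CN G A → a ∈ A → Adj G a b
  CN-adjacent b∈CN[A] = Equivalence.to ∈-CN⇔ b∈CN[A]

  CN-4-cycle : ∀ {A a₁ a₂ b₁ b₂} → a₁ ≢ a₂ → b₁ ≢ b₂ → a₁ ∈ A → a₂ ∈ A → b₁ ∈ CN G A → b₂ ∈ CN G A →
    Is4Cycle G (quad a₁ b₁ a₂ b₂)
  CN-4-cycle a₁≢a₂ b₁≢b₂ a₁∈A a₂∈A b₁∈CN[A] b₂∈CN[A] =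
    CN-adjacent b₁∈CN[A] a₁∈A , Adj-sym (CN-adjacent b₁∈CN[A] a₂∈A) ,
    CN-adjacent b₂∈CN[A] a₂∈A , Adj-sym (CN-adjacent b₂∈CN[A] a₁∈A) , a₁≢a₂ , b₁≢b₂

  connected-induction : Connected G → (P : Fin n → Set) →
    (∀ {s t} → Adj G s t → P s → P t) → ∀ {v} → P v → ∀ w → P w
  connected-induction connected P step {v} Pv w = Star-induction P step (connected v w) Pv

  has-neighbour : Connected G → ¬ Bipartite G → ∀ v → ∃ (Adj G v)
  has-neighbour connected non-bipartite v with any? (λ w → T? (adj G v w))
  ... | yes found = found
  ... | no  none  = contradiction ((λ _ → true) , λ s t st → contradiction st (no-edge s t)) non-bipartite
    where
    only-v : ∀ w → w ≡ v
    only-v = connected-induction connected (_≡ v) (λ { st refl → contradiction (_ , st) none }) refl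
    no-edge : ∀ s t → ¬ Adj G s t
    no-edge s t st = Adj⇒≢ st (trans (only-v s) (≡-sym (only-v t)))

-- A propositional form of Defs.edgeB: unlike T (edgeB q x y), it does not hide x and y behind
-- decisions, so they can be inferred from it.
Joins : Fin n → Fin n → Fin n → Fin n → Set
Joins s t x y = (x ≡ s × y ≡ t) ⊎ (x ≡ t × y ≡ s)

EdgeOf : Quad n → Fin n → Fin n → Set
EdgeOf (quad a b c d) x y = Joins a b x y ⊎ Joins b c x y ⊎ Joins c d x y ⊎ Joins d a x y

QuadEdge⇔EdgeOf : ∀ q (x y : Fin n) → QuadEdge q x y ⇔ EdgeOf q x y
QuadEdge⇔EdgeOf (quad a b c d) x y =
  ⇔-trans T-∨ (T-Joins ⊎-⇔ ⇔-trans T-∨ (T-Joins ⊎-⇔ ⇔-trans T-∨ (T-Joins ⊎-⇔ T-Joins)))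
  where
  T-≟ : ∀ {x s : Fin n} → T ⌊ x ≟ s ⌋ ⇔ x ≡ s
  T-≟ = mk⇔ toWitness fromWitness
  T-Joins : ∀ {s t x y : Fin n} → T ((⌊ x ≟ s ⌋ ∧ ⌊ y ≟ t ⌋) ∨ (⌊ x ≟ t ⌋ ∧ ⌊ y ≟ s ⌋)) ⇔ Joins s t x y
  T-Joins = ⇔-trans T-∨ (⇔-trans T-∧ (T-≟ ×-⇔ T-≟) ⊎-⇔ ⇔-trans T-∧ (T-≟ ×-⇔ T-≟))

EdgeOf-sym : ∀ q {x y : Fin n} → EdgeOf q x y → EdgeOf q y x
EdgeOf-sym q = Data.Sum.map flip (Data.Sum.map flip (Data.Sum.map flip flip))
  where
  flip : ∀ {s t x y : Fin n} → Joins s t x y → Joins s t y x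
  flip (inj₁ (refl , refl)) = inj₂ (refl , refl)
  flip (inj₂ (refl , refl)) = inj₁ (refl , refl)

module _ {a b c d : Fin n} where

  edge-ab : EdgeOf (quad a b c d) a b
  edge-ab = inj₁ (inj₁ (refl , refl))

  edge-bc : EdgeOf (quad a b c d) b c
  edge-bc = inj₂ (inj₁ (inj₁ (refl , refl)))

  edge-cd : EdgeOf (quad a b c d) c d
  edge-cd = inj₂ (inj₂ (inj₁ (inj₁ (refl , refl))))

  edge-da : EdgeOf (quad a b c d) d a
  edge-da = inj₂ (inj₂ (inj₂ (inj₁ (refl , refl))))

  quad-edge-across : ∀ {s t} → s ∈[ a , c ] → t ∈[ b , d ] → EdgeOf (quad a b c d) s t
  quad-edge-across (inj₁ refl) (inj₁ refl) = edge-ab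
  quad-edge-across (inj₁ refl) (inj₂ refl) = EdgeOf-sym (quad a b c d) edge-da
  quad-edge-across (inj₂ refl) (inj₁ refl) = EdgeOf-sym (quad a b c d) edge-bc
  quad-edge-across (inj₂ refl) (inj₂ refl) = edge-cd

  quad-sides : ∀ {s t} → EdgeOf (quad a b c d) s t →
    (s ∈[ a , c ] × t ∈[ b , d ]) ⊎ (s ∈[ b , d ] × t ∈[ a , c ])
  quad-sides (inj₁ (inj₁ (refl , refl)))               = inj₁ (inj₁ refl , inj₁ refl)
  quad-sides (inj₁ (inj₂ (refl , refl)))               = inj₂ (inj₁ refl , inj₁ refl)
  quad-sides (inj₂ (inj₁ (inj₁ (refl , refl))))        = inj₂ (inj₁ refl , inj₂ refl)
  quad-sides (inj₂ (inj₁ (inj₂ (refl , refl))))        = inj₁ (inj₂ refl , inj₁ refl)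
  quad-sides (inj₂ (inj₂ (inj₁ (inj₁ (refl , refl))))) = inj₁ (inj₂ refl , inj₂ refl)
  quad-sides (inj₂ (inj₂ (inj₁ (inj₂ (refl , refl))))) = inj₂ (inj₂ refl , inj₂ refl)
  quad-sides (inj₂ (inj₂ (inj₂ (inj₁ (refl , refl))))) = inj₂ (inj₂ refl , inj₁ refl)
  quad-sides (inj₂ (inj₂ (inj₂ (inj₂ (refl , refl))))) = inj₁ (inj₁ refl , inj₂ refl)

SameEdges : Quad n → Quad n → Set
SameEdges q r = ∀ {x y} → EdgeOf q x y ⇔ EdgeOf r x y

edgeB≡⇒SameEdges : ∀ {q r : Quad n} → (∀ x y → edgeB q x y ≡ edgeB r x y) → SameEdges q r
edgeB≡⇒SameEdges {q = q} {r} eq {x} {y} = mk⇔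
  (Equivalence.to (QuadEdge⇔EdgeOf r x y) ∘ subst T (eq x y) ∘ Equivalence.from (QuadEdge⇔EdgeOf q x y))
  (Equivalence.to (QuadEdge⇔EdgeOf q x y) ∘ subst T (≡-sym (eq x y)) ∘ Equivalence.from (QuadEdge⇔EdgeOf r x y))

SameEdges-sym : ∀ {q r : Quad n} → SameEdges q r → SameEdges r q
SameEdges-sym q≈r = ⇔-sym q≈r

SameEdges-trans : ∀ {q r s : Quad n} → SameEdges q r → SameEdges r s → SameEdges q s
SameEdges-trans q≈r r≈s = ⇔-trans q≈r r≈s

module _ {a b c d : Fin n} where

  rotate-SameEdges : SameEdges (quad a b c d) (quad b c d a)
  rotate-SameEdges = mk⇔
    (λ { (inj₁ e) → inj₂ (inj₂ (inj₂ e)) ; (inj₂ (inj₁ e)) → inj₁ e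
       ; (inj₂ (inj₂ (inj₁ e))) → inj₂ (inj₁ e) ; (inj₂ (inj₂ (inj₂ e))) → inj₂ (inj₂ (inj₁ e)) })
    (λ { (inj₂ (inj₂ (inj₂ e))) → inj₁ e ; (inj₁ e) → inj₂ (inj₁ e)
       ; (inj₂ (inj₁ e)) → inj₂ (inj₂ (inj₁ e)) ; (inj₂ (inj₂ (inj₁ e))) → inj₂ (inj₂ (inj₂ e)) })

  reflect-SameEdges : SameEdges (quad a b c d) (quad b a d c)
  reflect-SameEdges = mk⇔ mirror mirror
    where
    mirror : ∀ {a b c d x y : Fin n} → EdgeOf (quad a b c d) x y → EdgeOf (quad b a d c) x y
    mirror (inj₁ e)               = inj₁ (Data.Sum.swap e)
    mirror (inj₂ (inj₁ e))        = inj₂ (inj₂ (inj₂ (Data.Sum.swap e)))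
    mirror (inj₂ (inj₂ (inj₁ e))) = inj₂ (inj₂ (inj₁ (Data.Sum.swap e)))
    mirror (inj₂ (inj₂ (inj₂ e))) = inj₂ (inj₁ (Data.Sum.swap e))

_≟-Quad_ : (q r : Quad n) → Dec (q ≡ r)
quad a b c d ≟-Quad quad a′ b′ c′ d′ =
  map′ (λ { (refl , refl , refl , refl) → refl }) (λ { refl → refl , refl , refl , refl })
       (a ≟ a′ ×-dec b ≟ b′ ×-dec c ≟ c′ ×-dec d ≟ d′)

module _ (G : Graph n) where

  Joins-Adj : ∀ {s t x y} → Adj G s t → Joins s t x y → Adj G x y
  Joins-Adj st (inj₁ (refl , refl)) = st
  Joins-Adj st (inj₂ (refl , refl)) = Adj-sym G st

  Is4Cycle-edge : ∀ {q s t} → Is4Cycle G q → EdgeOf q s t → Adj G s t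
  Is4Cycle-edge {quad a b c d} (ab , bc , cd , da , _) =
    [ Joins-Adj ab , [ Joins-Adj bc , [ Joins-Adj cd , Joins-Adj da ] ] ]

  Is4Cycle-rotate : ∀ {a b c d} → Is4Cycle G (quad a b c d) → Is4Cycle G (quad b c d a)
  Is4Cycle-rotate (ab , bc , cd , da , a≢c , b≢d) = bc , cd , da , ab , b≢d , a≢c ∘ ≡-sym

  Is4Cycle-reflect : ∀ {a b c d} → Is4Cycle G (quad a b c d) → Is4Cycle G (quad b a d c)
  Is4Cycle-reflect (ab , bc , cd , da , a≢c , b≢d) =
    Adj-sym G ab , Adj-sym G da , Adj-sym G cd , Adj-sym G bc , b≢d , a≢c

  Is4Cycle-sides-disjoint : ∀ {a b c d s} → Is4Cycle G (quad a b c d) → s ∈[ a , c ] → ¬ s ∈[ b , d ]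
  Is4Cycle-sides-disjoint (ab , _  , _  , _  , _) (inj₁ refl) (inj₁ refl) = Adj⇒≢ G ab refl
  Is4Cycle-sides-disjoint (_  , _  , _  , da , _) (inj₁ refl) (inj₂ refl) = Adj⇒≢ G da refl
  Is4Cycle-sides-disjoint (_  , bc , _  , _  , _) (inj₂ refl) (inj₁ refl) = Adj⇒≢ G bc refl
  Is4Cycle-sides-disjoint (_  , _  , cd , _  , _) (inj₂ refl) (inj₂ refl) = Adj⇒≢ G cd refl

  Is4Cycle-side : ∀ {a b c d s t} → Is4Cycle G (quad a b c d) → EdgeOf (quad a b c d) s t →
    s ∈[ a , c ] → t ∈[ b , d ]
  Is4Cycle-side cyc e s∈ac with quad-sides e
  ... | inj₁ (_ , t∈bd)    = t∈bd
  ... | inj₂ (s∈bd , _)    = contradiction s∈bd (Is4Cycle-sides-disjoint cyc s∈ac)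

  Is4Cycle-side′ : ∀ {a b c d s t} → Is4Cycle G (quad a b c d) → EdgeOf (quad a b c d) s t →
    s ∈[ b , d ] → t ∈[ a , c ]
  Is4Cycle-side′ cyc e s∈bd =
    Data.Sum.swap (Is4Cycle-side (Is4Cycle-rotate cyc) (Equivalence.to rotate-SameEdges e) s∈bd)

  Rooted : Quad n → Fin n → Fin n → Set
  Rooted q s t = ∃₂ λ x y → Is4Cycle G (quad s t x y) × SameEdges q (quad s t x y)

  Is4Cycle-rooted-first : ∀ {a b c d s t} → Is4Cycle G (quad a b c d) → Joins a b s t →
    Rooted (quad a b c d) s t
  Is4Cycle-rooted-first cyc (inj₁ (refl , refl)) = _ , _ , cyc , ⇔-refl
  Is4Cycle-rooted-first cyc (inj₂ (refl , refl)) = _ , _ , Is4Cycle-reflect cyc , reflect-SameEdges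

  Rooted-resp : ∀ {q r s t} → SameEdges q r → Rooted r s t → Rooted q s t
  Rooted-resp q≈r (x , y , cyc , r≈) = x , y , cyc , SameEdges-trans q≈r r≈

  Is4Cycle-rooted : ∀ {q s t} → Is4Cycle G q → EdgeOf q s t → Rooted q s t
  Is4Cycle-rooted {quad a b c d} cyc (inj₁ e) = Is4Cycle-rooted-first cyc e
  Is4Cycle-rooted {quad a b c d} cyc (inj₂ (inj₁ e)) =
    Rooted-resp rotate-SameEdges
      (Is4Cycle-rooted-first (Is4Cycle-rotate cyc) e)
  Is4Cycle-rooted {quad a b c d} cyc (inj₂ (inj₂ (inj₁ e))) =
    Rooted-resp rotate-SameEdges (Rooted-resp rotate-SameEdges
      (Is4Cycle-rooted-first (Is4Cycle-rotate (Is4Cycle-rotate cyc)) e))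
  Is4Cycle-rooted {quad a b c d} cyc (inj₂ (inj₂ (inj₂ e))) =
    Rooted-resp (SameEdges-sym rotate-SameEdges)
      (Is4Cycle-rooted-first (Is4Cycle-rotate (Is4Cycle-rotate (Is4Cycle-rotate cyc))) e)

module _ {x y : Fin n} where

  countFaces-∷-edge : ∀ {f fs} → QuadEdge f x y → countFaces (f ∷ fs) x y ≡ suc (countFaces fs x y)
  countFaces-∷-edge {f} f-xy with edgeB f x y
  ... | true = refl

  countFaces-∷-cong : ∀ {f fs fs′} → countFaces fs x y ≡ suc (countFaces fs′ x y) →
    countFaces (f ∷ fs) x y ≡ suc (countFaces (f ∷ fs′) x y)
  countFaces-∷-cong {f} eq with edgeB f x y
  ... | true  = cong suc eq
  ... | false = eq

  countFaces-remove : ∀ {fs f} → f ∈ₗ fs → QuadEdge f x y →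
    ∃ λ fs′ → countFaces fs x y ≡ suc (countFaces fs′ x y) × (∀ {g} → g ∈ₗ fs → g ≢ f → g ∈ₗ fs′)
  countFaces-remove {f ∷ fs} (here refl) f-xy =
    fs , countFaces-∷-edge f-xy , λ { (here refl) g≢f → contradiction refl g≢f ; (there g∈) _ → g∈ }
  countFaces-remove {h ∷ fs} (there f∈) f-xy with countFaces-remove f∈ f-xy
  ... | fs′ , eq , keep =
    h ∷ fs′ , countFaces-∷-cong eq , λ { (here refl) _ → here refl ; (there g∈) g≢f → there (keep g∈ g≢f) }

  countFaces-≤2 : ∀ {fs g₁ g₂ h} → countFaces fs x y ≡ 2 → g₁ ≢ g₂ →
    g₁ ∈ₗ fs → QuadEdge g₁ x y → g₂ ∈ₗ fs → QuadEdge g₂ x y → h ∈ₗ fs → QuadEdge h x y → h ≡ g₁ ⊎ h ≡ g₂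
  countFaces-≤2 {h = h} two g₁≢g₂ g₁∈ g₁-xy g₂∈ g₂-xy h∈ h-xy with h ≟-Quad _ | h ≟-Quad _
  ... | yes h≡g₁ | _         = inj₁ h≡g₁
  ... | no  _    | yes h≡g₂  = inj₂ h≡g₂
  ... | no  h≢g₁ | no  h≢g₂  with countFaces-remove g₁∈ g₁-xy
  ... | _ , eq₁ , keep₁ with countFaces-remove (keep₁ g₂∈ (g₁≢g₂ ∘ ≡-sym)) g₂-xy
  ... | _ , eq₂ , keep₂ with countFaces-remove (keep₂ (keep₁ h∈ h≢g₁) h≢g₂) h-xy
  ... | _ , eq₃ , _ with trans (≡-sym two) (trans eq₁ (cong suc (trans eq₂ (cong suc eq₃))))
  ... | ()

  countFaces-nonzero : ∀ fs → countFaces fs x y ≢ 0 → ∃ λ f → f ∈ₗ fs × QuadEdge f x y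
  countFaces-nonzero []       c≢0 = contradiction refl c≢0
  countFaces-nonzero (f ∷ fs) c≢0 with edgeB f x y in e
  ... | true  = f , here refl , subst T (≡-sym e) tt
  ... | false with countFaces-nonzero fs c≢0
  ... | g , g∈ , g-xy = g , there g∈ , g-xy

module _ {x y x′ y′ : Fin n} where

  countFaces-mono : ∀ fs → (∀ {h} → h ∈ₗ fs → QuadEdge h x y → QuadEdge h x′ y′) →
    countFaces fs x y ≤ countFaces fs x′ y′
  countFaces-mono []       _   = z≤n
  countFaces-mono (f ∷ fs) sub with edgeB f x y in e | edgeB f x′ y′ in e′
  ... | true  | true  = s≤s (countFaces-mono fs (sub ∘ there))
  ... | false | false = countFaces-mono fs (sub ∘ there)
  ... | false | true  = m≤n⇒m≤1+n (countFaces-mono fs (sub ∘ there))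
  ... | true  | false = ⊥-elim (subst T e′ (sub (here refl) (subst T (≡-sym e) tt)))

  countFaces-mono-< : ∀ fs → (∀ {h} → h ∈ₗ fs → QuadEdge h x y → QuadEdge h x′ y′) →
    ∀ {h} → h ∈ₗ fs → QuadEdge h x′ y′ → ¬ QuadEdge h x y → countFaces fs x y < countFaces fs x′ y′
  countFaces-mono-< (f ∷ fs) sub (here refl) h-x′y′ h-¬xy with edgeB f x y | edgeB f x′ y′
  ... | true  | _     = ⊥-elim (h-¬xy _)
  ... | false | false = ⊥-elim h-x′y′
  ... | false | true  = s≤s (countFaces-mono fs (sub ∘ there))
  countFaces-mono-< (f ∷ fs) sub (there h∈) h-x′y′ h-¬xy with edgeB f x y in e | edgeB f x′ y′ in e′
  ... | true  | true  = s≤s (countFaces-mono-< fs (sub ∘ there) h∈ h-x′y′ h-¬xy)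
  ... | false | false = countFaces-mono-< fs (sub ∘ there) h∈ h-x′y′ h-¬xy
  ... | false | true  = m≤n⇒m≤1+n (countFaces-mono-< fs (sub ∘ there) h∈ h-x′y′ h-¬xy)
  ... | true  | false = ⊥-elim (subst T e′ (sub (here refl) (subst T (≡-sym e) tt)))

  countFaces-≡-reverse : ∀ fs → (∀ {h} → h ∈ₗ fs → QuadEdge h x y → QuadEdge h x′ y′) →
    countFaces fs x y ≡ countFaces fs x′ y′ → ∀ {h} → h ∈ₗ fs → QuadEdge h x′ y′ → QuadEdge h x y
  countFaces-≡-reverse fs sub eq {h} h∈ h-x′y′ with T? (edgeB h x y)
  ... | yes h-xy  = h-xy
  ... | no  h-¬xy = contradiction (subst (_< _) eq (countFaces-mono-< fs sub h∈ h-x′y′ h-¬xy)) (<-irrefl refl)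

module Faces {G : Graph n} (Q : Quadrangulation G) where

  FaceAt : Fin n → Fin n → Quad n → Set
  FaceAt s t h = h ∈ₗ faces Q × EdgeOf h s t

  private
    QuadEdge⇒EdgeOf : ∀ (h : Quad n) s t → QuadEdge h s t → EdgeOf h s t
    QuadEdge⇒EdgeOf h s t = Equivalence.to (QuadEdge⇔EdgeOf h s t)

    EdgeOf⇒QuadEdge : ∀ (h : Quad n) s t → EdgeOf h s t → QuadEdge h s t
    EdgeOf⇒QuadEdge h s t = Equivalence.from (QuadEdge⇔EdgeOf h s t)

  FaceAt-sym : ∀ {s t h} → FaceAt s t h → FaceAt t s h
  FaceAt-sym (h∈ , e) = h∈ , EdgeOf-sym _ e

  FaceAt-rooted : ∀ {s t h} → FaceAt s t h → Rooted G h s t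
  FaceAt-rooted (h∈ , e) = Is4Cycle-rooted G (faces-4-cycles Q h∈) e

  face-at-edge : ∀ {s t} → Adj G s t → ∃ (FaceAt s t)
  face-at-edge {s} {t} st
    with countFaces-nonzero (faces Q) (λ c≡0 → contradiction (trans (≡-sym (edge-two-faces Q s t st)) c≡0) λ ())
  ... | h , h∈ , e = h , h∈ , QuadEdge⇒EdgeOf h s t e

  face-of : AllFourCyclesFacial Q → ∀ {c} → Is4Cycle G c → ∃ λ f → f ∈ₗ faces Q × SameEdges f c
  face-of facial {c} cyc with facial c cyc
  ... | f , f∈ , f≈c = f , f∈ , edgeB≡⇒SameEdges f≈c

  faces-at-edge-≤2 : ∀ {s t g₁ g₂ h} → Adj G s t → g₁ ≢ g₂ →
    FaceAt s t g₁ → FaceAt s t g₂ → FaceAt s t h → h ≡ g₁ ⊎ h ≡ g₂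
  faces-at-edge-≤2 {s} {t} {g₁} {g₂} {h} st g₁≢g₂ (g₁∈ , e₁) (g₂∈ , e₂) (h∈ , e) =
    countFaces-≤2 (edge-two-faces Q s t st) g₁≢g₂
      g₁∈ (EdgeOf⇒QuadEdge g₁ s t e₁) g₂∈ (EdgeOf⇒QuadEdge g₂ s t e₂) h∈ (EdgeOf⇒QuadEdge h s t e)

  -- Faces are counted with multiplicity; both edges lie on exactly two of them, so an inclusion
  -- between the faces at the two edges is an equality.
  faces-at-edge-reverse : ∀ {s t s′ t′} → Adj G s t → Adj G s′ t′ →
    (∀ {h} → FaceAt s t h → EdgeOf h s′ t′) → ∀ {h} → FaceAt s′ t′ h → EdgeOf h s t
  faces-at-edge-reverse {s} {t} {s′} {t′} st s′t′ sub {h} (h∈ , e) = QuadEdge⇒EdgeOf h s t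
    (countFaces-≡-reverse (faces Q) (λ {g} g∈ e → EdgeOf⇒QuadEdge g s′ t′ (sub (g∈ , QuadEdge⇒EdgeOf g s t e)))
      (trans (edge-two-faces Q s t st) (≡-sym (edge-two-faces Q s′ t′ s′t′))) h∈ (EdgeOf⇒QuadEdge h s′ t′ e))

  link-induction : ∀ {s} (P : Fin n → Set) →
    (∀ {h w w′} → FaceAt s w h → EdgeOf h s w′ → P w → P w′) →
    ∀ {u} → Adj G s u → P u → ∀ {w} → Adj G s w → P w
  link-induction {s} P step {u} su Pu {w} sw = Star-induction P
    (λ {w} {w′} (h , h∈ , e , e′ , _) → step (h∈ , QuadEdge⇒EdgeOf h s w e) (QuadEdge⇒EdgeOf h s w′ e′))
    (link-connected Q s u w su sw) Pu

  OnlyFace : Quad n → Fin n → Fin n → Set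
  OnlyFace E s t = ∀ {h} → FaceAt s t h → SameEdges h E

  OnlyFace-spread : ∀ {E s t s′ t′} → Is4Cycle G E → EdgeOf E s t → EdgeOf E s′ t′ →
    OnlyFace E s t → OnlyFace E s′ t′
  OnlyFace-spread cyc e e′ only (h∈ , h-s′t′) = only (h∈ , faces-at-edge-reverse
    (Is4Cycle-edge G cyc e) (Is4Cycle-edge G cyc e′) (λ g-at → Equivalence.from (only g-at) e′) (h∈ , h-s′t′))

  Closed : Quad n → Set
  Closed E = ∀ {s t} → EdgeOf E s t → OnlyFace E s t

  Closed-rotate : ∀ {a b c d} → Closed (quad a b c d) → Closed (quad b c d a)
  Closed-rotate closed e h-at =
    SameEdges-trans (closed (Equivalence.from rotate-SameEdges e) h-at) rotate-SameEdges

  Closed-neighbours : ∀ {a b c d s w} → Is4Cycle G (quad a b c d) → Closed (quad a b c d) →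
    s ∈[ a , c ] → Adj G s w → w ∈[ b , d ]
  Closed-neighbours {a} {b} {c} {d} {s} cyc@(ab , bc , _) closed s∈ac =
    link-induction (_∈[ b , d ]) step (start s∈ac) (inj₁ refl)
    where
    start : s ∈[ a , c ] → Adj G s b
    start (inj₁ refl) = ab
    start (inj₂ refl) = Adj-sym G bc
    step : ∀ {h w w′} → FaceAt s w h → EdgeOf h s w′ → w ∈[ b , d ] → w′ ∈[ b , d ]
    step h-at e′ w∈bd =
      Is4Cycle-side G cyc (Equivalence.to (closed (quad-edge-across s∈ac w∈bd) h-at) e′) s∈ac

  Closed⇒Bipartite : Connected G → ∀ {a b c d} → Is4Cycle G (quad a b c d) → Closed (quad a b c d) →
    Bipartite G
  Closed⇒Bipartite connected {a} {b} {c} {d} cyc closed = colour , proper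
    where
    neighbours-ac : ∀ {s w} → s ∈[ a , c ] → Adj G s w → w ∈[ b , d ]
    neighbours-ac = Closed-neighbours cyc closed
    neighbours-bd : ∀ {s w} → s ∈[ b , d ] → Adj G s w → w ∈[ a , c ]
    neighbours-bd s∈bd sw = Data.Sum.swap (Closed-neighbours (Is4Cycle-rotate G cyc) (Closed-rotate closed) s∈bd sw)
    side : ∀ w → w ∈[ a , c ] ⊎ w ∈[ b , d ]
    side = connected-induction G connected _
      (λ { st (inj₁ s∈ac) → inj₂ (neighbours-ac s∈ac st) ; st (inj₂ s∈bd) → inj₁ (neighbours-bd s∈bd st) })
      (inj₁ (inj₁ refl))
    colour : Fin n → Bool
    colour w = does ((w ≟ a) ⊎-dec (w ≟ c))
    colour-ac : ∀ {w} → w ∈[ a , c ] → colour w ≡ true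
    colour-ac w∈ac = dec-true ((_ ≟ a) ⊎-dec (_ ≟ c)) w∈ac
    colour-bd : ∀ {w} → w ∈[ b , d ] → colour w ≡ false
    colour-bd w∈bd = dec-false ((_ ≟ a) ⊎-dec (_ ≟ c)) (λ w∈ac → Is4Cycle-sides-disjoint G cyc w∈ac w∈bd)
    proper : ∀ s t → Adj G s t → colour s ≢ colour t
    proper s t st with side s
    ... | inj₁ s∈ac rewrite colour-ac s∈ac | colour-bd (neighbours-ac s∈ac st) = λ ()
    ... | inj₂ s∈bd rewrite colour-bd s∈bd | colour-ac (neighbours-bd s∈bd st) = λ ()

record K₂,₃ (G : Graph n) : Set where
  field
    x : Fin 2 → Fin n
    y : Fin 3 → Fin n
    x-injective : Injective _≡_ _≡_ x
    y-injective : Injective _≡_ _≡_ y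
    adjacent : ∀ i j → Adj G (x i) (y j)

mkK₂,₃ : ∀ (G : Graph n) {x₀ x₁ y₀ y₁ y₂} → x₀ ≢ x₁ → y₀ ≢ y₁ → y₀ ≢ y₂ → y₁ ≢ y₂ →
  Adj G x₀ y₀ → Adj G x₀ y₁ → Adj G x₀ y₂ → Adj G x₁ y₀ → Adj G x₁ y₁ → Adj G x₁ y₂ → K₂,₃ G
mkK₂,₃ G {x₀} {x₁} {y₀} {y₁} {y₂} x₀≢x₁ y₀≢y₁ y₀≢y₂ y₁≢y₂ a₀₀ a₀₁ a₀₂ a₁₀ a₁₁ a₁₂ = record
  { x = x ; y = y ; x-injective = x-injective ; y-injective = y-injective ; adjacent = adjacent }
  where
  x : Fin 2 → Fin _
  x zero    = x₀
  x (suc _) = x₁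
  y : Fin 3 → Fin _
  y zero          = y₀
  y (suc zero)    = y₁
  y (suc (suc _)) = y₂
  x-injective : Injective _≡_ _≡_ x
  x-injective {zero}     {zero}     _  = refl
  x-injective {zero}     {suc zero} eq = contradiction eq x₀≢x₁
  x-injective {suc zero} {zero}     eq = contradiction (≡-sym eq) x₀≢x₁
  x-injective {suc zero} {suc zero} _  = refl
  y-injective : Injective _≡_ _≡_ y
  y-injective {zero}           {zero}           _  = refl
  y-injective {zero}           {suc zero}       eq = contradiction eq y₀≢y₁
  y-injective {zero}           {suc (suc zero)} eq = contradiction eq y₀≢y₂
  y-injective {suc zero}       {zero}           eq = contradiction (≡-sym eq) y₀≢y₁
  y-injective {suc zero}       {suc zero}       _  = refl
  y-injective {suc zero}       {suc (suc zero)} eq = contradiction eq y₁≢y₂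
  y-injective {suc (suc zero)} {zero}           eq = contradiction (≡-sym eq) y₀≢y₂
  y-injective {suc (suc zero)} {suc zero}       eq = contradiction (≡-sym eq) y₁≢y₂
  y-injective {suc (suc zero)} {suc (suc zero)} _  = refl
  adjacent : ∀ i j → Adj G (x i) (y j)
  adjacent zero    zero          = a₀₀
  adjacent zero    (suc zero)    = a₀₁
  adjacent zero    (suc (suc _)) = a₀₂
  adjacent (suc _) zero          = a₁₀
  adjacent (suc _) (suc zero)    = a₁₁
  adjacent (suc _) (suc (suc _)) = a₁₂

module K₂,₃-Rigidity {G : Graph n} (Q : Quadrangulation G) (facial : AllFourCyclesFacial Q)
                     (connected : Connected G) (K : K₂,₃ G) where

  open Faces Q
  open K₂,₃ K

  x≢y : ∀ i j → x i ≢ y j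
  x≢y i j = Adj⇒≢ G (adjacent i j)

  x∈[x₀,x₁] : ∀ i → x i ∈[ x zero , x (suc zero) ]
  x∈[x₀,x₁] zero       = inj₁ refl
  x∈[x₀,x₁] (suc zero) = inj₂ refl

  C : Fin 3 → Fin 3 → Quad n
  C j k = quad (y j) (x zero) (y k) (x (suc zero))

  C-4-cycle : ∀ {j k} → j ≢ k → Is4Cycle G (C j k)
  C-4-cycle {j} {k} j≢k =
    Adj-sym G (adjacent zero j) , adjacent zero k , Adj-sym G (adjacent (suc zero) k) , adjacent (suc zero) j ,
    j≢k ∘ y-injective , (λ ()) ∘ x-injective

  others : ∀ (j : Fin 3) → ∃₂ λ k l → j ≢ k × j ≢ l × k ≢ l
  others zero             = suc zero , suc (suc zero) , (λ ()) , (λ ()) , (λ ())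
  others (suc zero)       = zero , suc (suc zero) , (λ ()) , (λ ()) , (λ ())
  others (suc (suc zero)) = zero , suc zero , (λ ()) , (λ ()) , (λ ())

  -- For the two indices k, l other than j, the 4-cycles C j k and C j l bound distinct faces at the
  -- edge y j – x i, so these are all the faces there.
  spoke-faces : ∀ {i j h} → FaceAt (y j) (x i) h → ∃ λ k → j ≢ k × SameEdges h (C j k)
  spoke-faces {i} {j} h-at with others j
  ... | k , l , j≢k , j≢l , k≢l with face-of facial (C-4-cycle j≢k) | face-of facial (C-4-cycle j≢l)
  ... | g , g∈ , g≈ | g′ , g′∈ , g′≈
    with faces-at-edge-≤2 (Adj-sym G (adjacent i j)) g≢g′ (at g∈ g≈) (at g′∈ g′≈) h-at
    where
    at : ∀ {f l} → f ∈ₗ faces Q → SameEdges f (C j l) → FaceAt (y j) (x i) f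
    at f∈ f≈ = f∈ , Equivalence.from f≈ (quad-edge-across (inj₁ refl) (x∈[x₀,x₁] i))
    g≢g′ : g ≢ g′
    g≢g′ refl with Is4Cycle-side′ G (C-4-cycle j≢l) (Equivalence.to g′≈ (Equivalence.from g≈ edge-bc)) (inj₁ refl)
    ... | inj₁ yk≡yj = j≢k (≡-sym (y-injective yk≡yj))
    ... | inj₂ yk≡yl = k≢l (y-injective yk≡yl)
  ... | inj₁ refl = k , j≢k , g≈
  ... | inj₂ refl = l , j≢l , g′≈

  y-neighbours : ∀ {j w} → Adj G (y j) w → ∃ λ i → w ≡ x i
  y-neighbours {j} = link-induction (λ w → ∃ λ i → w ≡ x i) step (Adj-sym G (adjacent zero j)) (zero , refl)
    where
    step : ∀ {h w w′} → FaceAt (y j) w h → EdgeOf h (y j) w′ → ∃ (λ i → w ≡ x i) → ∃ λ i → w′ ≡ x i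
    step h-at e′ (i , refl) with spoke-faces h-at
    ... | k , j≢k , h≈ with Is4Cycle-side G (C-4-cycle j≢k) (Equivalence.to h≈ e′) (inj₁ refl)
    ... | inj₁ w′≡x₀ = zero , w′≡x₀
    ... | inj₂ w′≡x₁ = suc zero , w′≡x₁

  x-neighbours : ∀ {i w} → Adj G (x i) w → ∃ λ j → w ≡ y j
  x-neighbours {i} = link-induction (λ w → ∃ λ j → w ≡ y j) step (adjacent i zero) (zero , refl)
    where
    step : ∀ {h w w′} → FaceAt (x i) w h → EdgeOf h (x i) w′ → ∃ (λ j → w ≡ y j) → ∃ λ j → w′ ≡ y j
    step h-at e′ (j , refl) with spoke-faces (FaceAt-sym h-at)
    ... | k , j≢k , h≈ with Is4Cycle-side′ G (C-4-cycle j≢k) (Equivalence.to h≈ e′) (x∈[x₀,x₁] i)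
    ... | inj₁ w′≡yj = j , w′≡yj
    ... | inj₂ w′≡yk = k , w′≡yk

  vertex : Fin 2 ⊎ Fin 3 → Fin n
  vertex = [ x , y ]

  vertex-surjective : ∀ w → ∃ λ p → vertex p ≡ w
  vertex-surjective = connected-induction G connected (λ w → ∃ λ p → vertex p ≡ w) step (inj₁ zero , refl)
    where
    step : ∀ {s t} → Adj G s t → ∃ (λ p → vertex p ≡ s) → ∃ λ p → vertex p ≡ t
    step st (inj₁ i , refl) with x-neighbours st
    ... | j , refl = inj₂ j , refl
    step st (inj₂ j , refl) with y-neighbours st
    ... | i , refl = inj₁ i , refl

  vertex-injective : Injective _≡_ _≡_ vertex
  vertex-injective {inj₁ i} {inj₁ i′} eq = cong inj₁ (x-injective eq)
  vertex-injective {inj₁ i} {inj₂ j}  eq = contradiction eq (x≢y i j)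
  vertex-injective {inj₂ j} {inj₁ i}  eq = contradiction (≡-sym eq) (x≢y i j)
  vertex-injective {inj₂ j} {inj₂ j′} eq = cong inj₂ (y-injective eq)

  label : Fin n → Fin 2 ⊎ Fin 3
  label w = proj₁ (vertex-surjective w)

  vertex-label : ∀ w → vertex (label w) ≡ w
  vertex-label w = proj₂ (vertex-surjective w)

  label-vertex : ∀ p → label (vertex p) ≡ p
  label-vertex p = vertex-injective {label (vertex p)} {p} (vertex-label (vertex p))

  partK23-join : ∀ p → partK23 (join 2 3 p) ≡ [ (λ _ → true) , (λ _ → false) ] p
  partK23-join (inj₁ zero)             = refl
  partK23-join (inj₁ (suc zero))       = refl
  partK23-join (inj₂ zero)             = refl
  partK23-join (inj₂ (suc zero))       = refl
  partK23-join (inj₂ (suc (suc zero))) = refl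

  adj-vertex : ∀ p q → adj G (vertex p) (vertex q) ≡ adj K23 (join 2 3 p) (join 2 3 q)
  adj-vertex p q rewrite partK23-join p | partK23-join q with p | q
  ... | inj₁ i | inj₁ i′ = ¬T⇒≡false λ xx → let (j , eq) = x-neighbours xx in x≢y i′ j eq
  ... | inj₁ i | inj₂ j  = Equivalence.to T-≡ (adjacent i j)
  ... | inj₂ j | inj₁ i  = Equivalence.to T-≡ (Adj-sym G (adjacent i j))
  ... | inj₂ j | inj₂ j′ = ¬T⇒≡false λ yy → let (i , eq) = y-neighbours yy in x≢y i j′ (≡-sym eq)

  isomorphic : Isomorphic G K23
  isomorphic = σ , λ u v → subst₂ (λ u′ v′ → adj G u′ v′ ≡ adj K23 (join 2 3 (label u)) (join 2 3 (label v)))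
    (vertex-label u) (vertex-label v) (adj-vertex (label u) (label v))
    where
    σ : Fin n ↔ Fin 5
    σ = mk↔ₛ′ (join 2 3 ∘ label) (vertex ∘ splitAt 2)
      (λ k → trans (cong (join 2 3) (label-vertex (splitAt 2 k))) (join-splitAt 2 3 k))
      (λ w → trans (cong vertex (splitAt-join 2 3 (label w))) (vertex-label w))

CN-opposite : ∀ (G : Graph n) → ¬ K₂,₃ G → ∀ {a b c d} → Is4Cycle G (quad a b c d) →
  CN G (⁅ a ⁆ ∪ ⁅ c ⁆) ≡ ⁅ b ⁆ ∪ ⁅ d ⁆
CN-opposite G no-K₂,₃ {a} {b} {c} {d} (ab , bc , cd , da , a≢c , b≢d) = ⊆-antisym CN⊆bd bd⊆CN
  where
  CN⊆bd : CN G (⁅ a ⁆ ∪ ⁅ c ⁆) ⊆ ⁅ b ⁆ ∪ ⁅ d ⁆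
  CN⊆bd {w} w∈ with w ≟ b | w ≟ d
  ... | yes w≡b | _       = ∈-pair⁺ (inj₁ w≡b)
  ... | no  _   | yes w≡d = ∈-pair⁺ (inj₂ w≡d)
  ... | no  w≢b | no  w≢d = contradiction
    (mkK₂,₃ G a≢c b≢d (w≢b ∘ ≡-sym) (w≢d ∘ ≡-sym) ab (Adj-sym G da) (common (inj₁ refl))
                      (Adj-sym G bc) cd (common (inj₂ refl)))
    no-K₂,₃
    where
    common : ∀ {u} → u ∈[ a , c ] → Adj G u w
    common = Equivalence.to (∈-CN⇔ G) w∈ ∘ ∈-pair⁺
  bd⊆CN : ⁅ b ⁆ ∪ ⁅ d ⁆ ⊆ CN G (⁅ a ⁆ ∪ ⁅ c ⁆)
  bd⊆CN w∈ = Equivalence.from (∈-CN⇔ G) λ u∈ → adjacent (∈-pair⁻ u∈) (∈-pair⁻ w∈)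
    where
    adjacent : ∀ {u w} → u ∈[ a , c ] → w ∈[ b , d ] → Adj G u w
    adjacent (inj₁ refl) (inj₁ refl) = ab
    adjacent (inj₁ refl) (inj₂ refl) = Adj-sym G da
    adjacent (inj₂ refl) (inj₁ refl) = Adj-sym G bc
    adjacent (inj₂ refl) (inj₂ refl) = cd

module Classification {G : Graph n} (Q : Quadrangulation G) (facial : AllFourCyclesFacial Q)
                      (connected : Connected G) (non-bipartite : ¬ Bipartite G) (no-K₂,₃ : ¬ K₂,₃ G) where

  open Faces Q

  neighbour : ∀ v → ∃ (Adj G v)
  neighbour = has-neighbour G connected non-bipartite

  -- A face v a x b with x ≢ u would give a K₂,₃ with parts {a, b} and {v, x, u}.
  faces-at-degree-2 : ∀ {u v a b} → u ≢ v → a ≢ b → (∀ {w} → Adj G v w → w ∈[ a , b ]) →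
    Adj G v a → Adj G a u → Adj G u b → Adj G b v → OnlyFace (quad v a u b) v a
  faces-at-degree-2 {u} u≢v a≢b N[v]⊆ab va au ub bv h-at with FaceAt-rooted h-at
  ... | x , q , (_ , ax , xq , qv , v≢x , a≢q) , h≈ with N[v]⊆ab (Adj-sym G qv)
  ... | inj₁ refl = contradiction refl a≢q
  ... | inj₂ refl with x ≟ u
  ... | yes refl = h≈
  ... | no  x≢u  = contradiction
    (mkK₂,₃ G a≢b v≢x (u≢v ∘ ≡-sym) x≢u (Adj-sym G va) ax au bv (Adj-sym G xq) (Adj-sym G ub))
    no-K₂,₃

  undominated : ∀ {u v} → u ≢ v → ¬ (∀ {w} → Adj G v w → Adj G u w)
  undominated {u} {v} u≢v dominated with neighbour v
  ... | a , va with FaceAt-rooted (proj₂ (face-at-edge va))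
  ... | _ , b , (_ , _ , _ , bv , _ , a≢b) , _ with ⊆-or-∉ (N G v) (⁅ a ⁆ ∪ ⁅ b ⁆)
  ... | inj₂ (c , c∈N[v] , c∉ab) = no-K₂,₃
    (mkK₂,₃ G (u≢v ∘ ≡-sym) a≢b (c≢ (inj₁ refl)) (c≢ (inj₂ refl)) va (Adj-sym G bv) vc
       (dominated va) (dominated (Adj-sym G bv)) (dominated vc))
    where
    vc : Adj G v c
    vc = Equivalence.to (∈-N⇔ G) c∈N[v]
    c≢ : ∀ {w} → w ∈[ a , b ] → w ≢ c
    c≢ w∈ab refl = c∉ab (∈-pair⁺ w∈ab)
  ... | inj₁ N[v]⊆ab = non-bipartite (Closed⇒Bipartite connected cyc closed)
    where
    au : Adj G a u
    au = Adj-sym G (dominated va)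
    ub : Adj G u b
    ub = dominated (Adj-sym G bv)
    cyc : Is4Cycle G (quad v a u b)
    cyc = va , au , ub , bv , u≢v ∘ ≡-sym , a≢b
    closed : Closed (quad v a u b)
    closed e = OnlyFace-spread cyc edge-ab e
      (faces-at-degree-2 u≢v a≢b (∈-pair⁻ ∘ N[v]⊆ab ∘ Equivalence.from (∈-N⇔ G)) va au ub bv)

  no-domination : ∀ {u v} → N G v ⊆ N G u → u ≡ v
  no-domination {u} {v} N[v]⊆N[u] with u ≟ v
  ... | yes u≡v = u≡v
  ... | no  u≢v = ⊥-elim (undominated u≢v λ vw →
    Equivalence.to (∈-N⇔ G) (N[v]⊆N[u] (Equivalence.from (∈-N⇔ G) vw)))

  LovaszVertex-⁅⁆ : ∀ v → LovaszVertex G ⁅ v ⁆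
  LovaszVertex-⁅⁆ v =
    ∈⇒≢⊥ (x∈⁅x⁆ v) ,
    ∉⇒≢⊤ (λ a∈v → Adj⇒≢ G (proj₂ (neighbour v)) (≡-sym (x∈⁅y⁆⇒x≡y v a∈v))) ,
    trans (cong (CN G) (CN-⁅⁆ G v)) (CN-N G v no-domination)

  LovaszVertex-N : ∀ v → LovaszVertex G (N G v)
  LovaszVertex-N v =
    ∈⇒≢⊥ (Equivalence.from (∈-N⇔ G) (proj₂ (neighbour v))) ,
    ∉⇒≢⊤ (λ v∈N[v] → Adj⇒≢ G (Equivalence.to (∈-N⇔ G) v∈N[v]) refl) ,
    trans (cong (CN G) (CN-N G v no-domination)) (CN-⁅⁆ G v)

  LovaszVertex-opposite : ∀ {a b c d} → Is4Cycle G (quad a b c d) → LovaszVertex G (⁅ a ⁆ ∪ ⁅ c ⁆)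
  LovaszVertex-opposite {a} {b} {c} {d} cyc =
    ∈⇒≢⊥ (∈-pair⁺ (inj₁ refl)) ,
    ∉⇒≢⊤ (λ b∈ac → Is4Cycle-sides-disjoint G cyc (∈-pair⁻ b∈ac) (inj₁ refl)) ,
    (begin
      CN G (CN G (⁅ a ⁆ ∪ ⁅ c ⁆)) ≡⟨ cong (CN G) (CN-opposite G no-K₂,₃ cyc) ⟩
      CN G (⁅ b ⁆ ∪ ⁅ d ⁆)        ≡⟨ CN-opposite G no-K₂,₃ (Is4Cycle-rotate G cyc) ⟩
      ⁅ c ⁆ ∪ ⁅ a ⁆               ≡⟨ ∪-comm _ _ ⟩
      ⁅ a ⁆ ∪ ⁅ c ⁆               ∎)
    where open ≡-Reasoning

  OppositePair-of-4-cycle : ∀ {a b c d} → Is4Cycle G (quad a b c d) → OppositePair Q (⁅ a ⁆ ∪ ⁅ c ⁆)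
  OppositePair-of-4-cycle {a} {c = c} cyc with face-of facial cyc
  ... | quad q₀ q₁ q₂ q₃ , f∈ , f≈ with faces-4-cycles Q f∈ | quad-sides (Equivalence.to f≈ edge-ab)
  ... | _ , _ , _ , _ , q₀≢q₂ , _ | inj₁ (q₀∈ac , q₁∈bd) =
    _ , f∈ , inj₁ (pair-≡ q₀∈ac (Is4Cycle-side′ G cyc (Equivalence.to f≈ edge-bc) q₁∈bd) q₀≢q₂)
  ... | _ , _ , _ , _ , _ , q₁≢q₃ | inj₂ (_ , q₁∈ac) =
    _ , f∈ , inj₂ (pair-≡ q₁∈ac q₃∈ac q₁≢q₃)
    where
    q₃∈ac : q₃ ∈[ a , c ]
    q₃∈ac = Is4Cycle-side′ G cyc (Equivalence.to f≈ edge-cd) (Is4Cycle-side G cyc (Equivalence.to f≈ edge-bc) q₁∈ac)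

  OppositePair-of-K₂,₂ : ∀ {A a₁ a₂ b₁ b₂} → a₁ ≢ a₂ → b₁ ≢ b₂ → a₁ ∈ A → a₂ ∈ A →
    b₁ ∈ CN G A → b₂ ∈ CN G A → OppositePair Q A
  OppositePair-of-K₂,₂ {A} {a₁} {a₂} {b₁} {b₂} a₁≢a₂ b₁≢b₂ a₁∈A a₂∈A b₁∈CN[A] b₂∈CN[A]
    with ⊆-or-∉ A (⁅ a₁ ⁆ ∪ ⁅ a₂ ⁆)
  ... | inj₁ A⊆a₁a₂ = subst (OppositePair Q) (≡-sym (⊆pair⇒≡ a₁∈A a₂∈A A⊆a₁a₂))
    (OppositePair-of-4-cycle (CN-4-cycle G a₁≢a₂ b₁≢b₂ a₁∈A a₂∈A b₁∈CN[A] b₂∈CN[A]))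
  ... | inj₂ (a₃ , a₃∈A , a₃∉a₁a₂) = contradiction
    (mkK₂,₃ G b₁≢b₂ a₁≢a₂
       (λ { refl → a₃∉a₁a₂ (∈-pair⁺ (inj₁ refl)) }) (λ { refl → a₃∉a₁a₂ (∈-pair⁺ (inj₂ refl)) })
       (b₁~ a₁∈A) (b₁~ a₂∈A) (b₁~ a₃∈A) (b₂~ a₁∈A) (b₂~ a₂∈A) (b₂~ a₃∈A))
    no-K₂,₃
    where
    b₁~ : ∀ {a} → a ∈ A → Adj G b₁ a
    b₁~ = Adj-sym G ∘ CN-adjacent G b₁∈CN[A]
    b₂~ : ∀ {a} → a ∈ A → Adj G b₂ a
    b₂~ = Adj-sym G ∘ CN-adjacent G b₂∈CN[A]

  Classified : Subset n → Set
  Classified A = OppositePair Q A ⊎ (∃ λ v → A ≡ N G v) ⊎ (∃ λ v → A ≡ ⁅ v ⁆)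

  LovaszVertex⇒Classified : ∀ {A} → LovaszVertex G A → Classified A
  LovaszVertex⇒Classified {A} (A≢⊥ , A≢⊤ , CN²A≡A) with ≢⊥⇒nonempty A≢⊥ | ≢⊥⇒nonempty CN[A]≢⊥
    where
    CN[A]≢⊥ : CN G A ≢ Subset.⊥
    CN[A]≢⊥ CN[A]≡⊥ = A≢⊤ (trans (≡-sym CN²A≡A) (trans (cong (CN G) CN[A]≡⊥) (CN-⊥ G)))
  ... | a₁ , a₁∈A | b₁ , b₁∈CN[A] with ⊆-or-∉ (CN G A) ⁅ b₁ ⁆ | ⊆-or-∉ A ⁅ a₁ ⁆
  ... | inj₁ CN[A]⊆b₁ | _ =
    inj₂ (inj₁ (b₁ , trans (≡-sym CN²A≡A) (trans (cong (CN G) (⊆⁅⁆⇒≡ b₁∈CN[A] CN[A]⊆b₁)) (CN-⁅⁆ G b₁))))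
  ... | inj₂ _ | inj₁ A⊆a₁ = inj₂ (inj₂ (a₁ , ⊆⁅⁆⇒≡ a₁∈A A⊆a₁))
  ... | inj₂ (b₂ , b₂∈CN[A] , b₂∉b₁) | inj₂ (a₂ , a₂∈A , a₂∉a₁) = inj₁
    (OppositePair-of-K₂,₂ (x∉⁅y⁆⇒x≢y a₂∉a₁ ∘ ≡-sym) (x∉⁅y⁆⇒x≢y b₂∉b₁ ∘ ≡-sym)
       a₁∈A a₂∈A b₁∈CN[A] b₂∈CN[A])

  Classified⇒LovaszVertex : ∀ {A} → Classified A → LovaszVertex G A
  Classified⇒LovaszVertex (inj₁ (f , f∈ , inj₁ refl)) = LovaszVertex-opposite (faces-4-cycles Q f∈)
  Classified⇒LovaszVertex (inj₁ (f , f∈ , inj₂ refl)) =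
    LovaszVertex-opposite (Is4Cycle-rotate G (faces-4-cycles Q f∈))
  Classified⇒LovaszVertex (inj₂ (inj₁ (v , refl)))    = LovaszVertex-N v
  Classified⇒LovaszVertex (inj₂ (inj₂ (v , refl)))    = LovaszVertex-⁅⁆ v

lemma3p2 : ∀ {n : ℕ} (G : Graph n) (Q : Quadrangulation G) →
    ¬ Isomorphic G K23 → Connected G → ¬ Bipartite G → AllFourCyclesFacial Q →
    ∀ (A : Subset n) →
      LovaszVertex G A ⇔
        (OppositePair Q A ⊎ (∃ λ v → A ≡ N G v) ⊎ (∃ λ v → A ≡ ⁅ v ⁆))
lemma3p2 G Q not-K23 connected non-bipartite facial A =
  mk⇔ LovaszVertex⇒Classified Classified⇒LovaszVertex
  where
  no-K₂,₃ : ¬ K₂,₃ G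
  no-K₂,₃ K = not-K23 (K₂,₃-Rigidity.isomorphic Q facial connected K)
  open Classification Q facial connected non-bipartite no-K₂,₃
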